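{- For integers $N\ge i\ge 0$, let $\alpha_{N,i}$ be the total number of $\mathbf{u}$-steps at level $i+1$ in all G-Motzkin paths of length $N+1$. Then for all integers $n,m\ge 0$, \[ \sum_{i=0}^{n}(-1)^{n-i}\binom{n}{i}\alpha_{n+m+i,\,m+i}=5^{n}. \]
   Context: A G-Motzkin path of length $N$ is a lattice path from $(0,0)$ to $(N,0)$ that never goes below the $x$-axis and consists of up steps $\mathbf{u}=(1,1)$, down steps $\mathbf{d}=(1,-1)$, horizontal steps $\mathbf{h}=(1,0)$ and vertical steps $\mathbf{v}=(0,-1)$. A step is at level $\ell$ if the ordinate of its endpoint is $\ell$. -}

module Defs where

open import Data.Nat using (ℕ; zero; suc; _+_; _*_; _∸_; _^_; _≡ᵇ_)
open import Data.Bool using (Bool; true; false; _∧_; if_then_else_)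
import Data.List
open import Data.List using (List; []; _∷_; map; concatMap; filter; upTo; length)
open import Data.Nat.ListAction using (sum)
open import Data.Integer as ℤ using (ℤ)
open import Data.Nat.Combinatorics using (_C_)
open import Relation.Binary.PropositionalEquality using (_≡_)
open import Relation.Nullary.Decidable using (Dec)
open import Data.Bool using (T)
open import Data.Product using (_×_)
open import Data.Bool.Properties using (T?)

-- Steps: u = (1,1), d = (1,-1), h = (1,0), v = (0,-1).
data Step : Set where
  u d h v : Step

Path : Set
Path = List Step

xlen : Path → ℕ
xlen []       = 0
xlen (v ∷ p)  = xlen p
xlen (_ ∷ p)  = suc (xlen p)

validFrom : ℕ → Path → Bool
validFrom zero    []      = true
validFrom (suc _) []      = false
validFrom ℓ       (u ∷ p) = validFrom (suc ℓ) p
validFrom ℓ       (h ∷ p) = validFrom ℓ p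
validFrom zero    (d ∷ p) = false
validFrom (suc ℓ) (d ∷ p) = validFrom ℓ p
validFrom zero    (v ∷ p) = false
validFrom (suc ℓ) (v ∷ p) = validFrom ℓ p

IsGMotzkin : ℕ → Path → Set
IsGMotzkin N p = xlen p ≡ N × T (validFrom 0 p)

isGMotzkin? : ℕ → Path → Bool
isGMotzkin? N p = (xlen p ≡ᵇ N) ∧ validFrom 0 p

words : ℕ → List Path
words zero    = [] ∷ []
words (suc k) = concatMap (λ w → map (_∷ w) (u ∷ d ∷ h ∷ v ∷ [])) (words k)

-- A G-Motzkin path of
-- length N has #u + #d + #h = N steps of nonzero width and #v ≤ #u ≤ N,
-- hence at most 2N steps in total, so every such path is listed.
gMotzkinPaths : ℕ → List Path
gMotzkinPaths N = filter (λ p → T? (isGMotzkin? N p)) (concatMap words (upTo (suc (2 * N))))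

uStepsAtFrom : ℕ → ℕ → Path → ℕ
uStepsAtFrom ℓ s []      = 0
uStepsAtFrom ℓ s (u ∷ p) = (if suc s ≡ᵇ ℓ then 1 else 0) + uStepsAtFrom ℓ (suc s) p
uStepsAtFrom ℓ s (h ∷ p) = uStepsAtFrom ℓ s p
uStepsAtFrom ℓ s (d ∷ p) = uStepsAtFrom ℓ (s ∸ 1) p
uStepsAtFrom ℓ s (v ∷ p) = uStepsAtFrom ℓ (s ∸ 1) p

uStepsAt : ℕ → Path → ℕ
uStepsAt ℓ = uStepsAtFrom ℓ 0

α : ℕ → ℕ → ℕ
α N i = sum (map (uStepsAt (suc i)) (gMotzkinPaths (suc N)))

signPow : ℕ → ℤ
signPow zero    = ℤ.+ 1
signPow (suc k) = ℤ.- signPow k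

lhs : ℕ → ℕ → ℤ
lhs n m = Data.List.foldr ℤ._+_ (ℤ.+ 0)
  (map (λ i → signPow (n ∸ i) ℤ.* (ℤ.+ ((n C i) * α (n + m + i) (m + i)))) (upTo (suc n)))

-- Let M(z) be the generating function of G-Motzkin paths by length, R = (1 + z) M,
-- K = R M, and let U_ℓ(z) count their u-steps at level ℓ.  A first-step analysis of the paths
-- from every height s to the axis shows that those from height s + 1 are R times those from
-- height s, and from this that U_{ℓ+1} = z K U_ℓ for ℓ ≥ 1.  Hence β_e(k) := α_{e+k,k} satisfies β_0 = 1 and β_e(k+1) = Σ_{t ≤ e} K_t β_{e-t}(k)
-- with K_0 = 1, K_1 = 5, i.e. the forward difference in k lowers the excess e:
-- Δβ_e = Σ_{1 ≤ t ≤ e} K_t β_{e-t}.  By induction Δ^n β_e = 0 for e < n and Δ^n β_n = 5^n, and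
-- the left-hand side is the binomial expansion of (Δ^n β_n)(m).

module Submission where

open import Defs
open import Data.Nat using (ℕ; _^_)
open import Data.Integer as ℤ using (ℤ)
open import Relation.Binary.PropositionalEquality using (_≡_; trans)

module PowerSeries where
  open import Data.Nat using (zero; suc; _+_; _*_; _≤_; z≤n)
  open import Data.Nat.Properties
  open import Function using (_∘_)
  open import Relation.Binary.PropositionalEquality
  open import Algebra.Properties.CommutativeSemigroup *-commutativeSemigroup using () renaming (x∙yz≈y∙xz to x*[y*z]≡y*[x*z])
  open import Algebra.Properties.CommutativeSemigroup +-commutativeSemigroup using () renaming (interchange to +-interchange; x∙yz≈y∙xz to x+[y+z]≡y+[x+z])

  Ser : Set
  Ser = ℕ → ℕ

  infixl 6 _⊕_
  infixl 7 _⊗_ _·_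

  _⊕_ : Ser → Ser → Ser
  (f ⊕ g) n = f n + g n

  _·_ : ℕ → Ser → Ser
  (c · f) n = c * f n

  -- multiplication by z
  shift : Ser → Ser
  shift f zero    = 0
  shift f (suc n) = f n

  one : Ser
  one zero    = 1
  one (suc n) = 0

  _⊗_ : Ser → Ser → Ser
  (f ⊗ g) zero    = f 0 * g 0
  (f ⊗ g) (suc n) = f 0 * g (suc n) + ((f ∘ suc) ⊗ g) n

  shift-cong : ∀ {f g} → f ≗ g → shift f ≗ shift g
  shift-cong f≗g zero    = refl
  shift-cong f≗g (suc n) = f≗g n

  ⊗-congˡ : ∀ {f f′} g → f ≗ f′ → f ⊗ g ≗ f′ ⊗ g
  ⊗-congˡ g f≗f′ zero    = cong (_* g 0) (f≗f′ 0)
  ⊗-congˡ g f≗f′ (suc n) =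
    cong₂ _+_ (cong (_* g (suc n)) (f≗f′ 0)) (⊗-congˡ g (f≗f′ ∘ suc) n)

  ⊗-congʳ-≤ : ∀ f {g g′} n → (∀ k → k ≤ n → g k ≡ g′ k) → (f ⊗ g) n ≡ (f ⊗ g′) n
  ⊗-congʳ-≤ f zero    g≗g′ = cong (f 0 *_) (g≗g′ 0 z≤n)
  ⊗-congʳ-≤ f (suc n) g≗g′ =
    cong₂ _+_ (cong (f 0 *_) (g≗g′ (suc n) ≤-refl))
              (⊗-congʳ-≤ (f ∘ suc) n (λ k k≤n → g≗g′ k (m≤n⇒m≤1+n k≤n)))

  ⊗-congʳ : ∀ f {g g′} → g ≗ g′ → f ⊗ g ≗ f ⊗ g′
  ⊗-congʳ f g≗g′ n = ⊗-congʳ-≤ f n (λ k _ → g≗g′ k)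

  ⊗-zeroʳ-≤ : ∀ f g n → (∀ k → k ≤ n → g k ≡ 0) → (f ⊗ g) n ≡ 0
  ⊗-zeroʳ-≤ f g n g≡0 = trans (⊗-congʳ-≤ f n g≡0) (zeroʳ f n)
    where
    zeroʳ : ∀ f n → (f ⊗ (λ _ → 0)) n ≡ 0
    zeroʳ f zero    = *-zeroʳ (f 0)
    zeroʳ f (suc n) = trans (cong (_+ ((f ∘ suc) ⊗ (λ _ → 0)) n) (*-zeroʳ (f 0))) (zeroʳ (f ∘ suc) n)

  ⊗-identityʳ : ∀ f → f ⊗ one ≗ f
  ⊗-identityʳ f zero    = *-identityʳ (f 0)
  ⊗-identityʳ f (suc n) = trans (cong (_+ ((f ∘ suc) ⊗ one) n) (*-zeroʳ (f 0))) (⊗-identityʳ (f ∘ suc) n)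

  ⊗-shiftˡ : ∀ f g → shift f ⊗ g ≗ shift (f ⊗ g)
  ⊗-shiftˡ f g zero    = refl
  ⊗-shiftˡ f g (suc n) = refl

  ⊗-shiftʳ : ∀ f g → f ⊗ shift g ≗ shift (f ⊗ g)
  ⊗-shiftʳ f g zero          = *-zeroʳ (f 0)
  ⊗-shiftʳ f g (suc zero)    = trans (cong (f 0 * g 0 +_) (*-zeroʳ (f 1))) (+-identityʳ _)
  ⊗-shiftʳ f g (suc (suc n)) = cong (f 0 * g (suc n) +_) (⊗-shiftʳ (f ∘ suc) g (suc n))

  ⊗-scaleˡ : ∀ c f g → (c · f) ⊗ g ≗ c · (f ⊗ g)
  ⊗-scaleˡ c f g zero    = *-assoc c (f 0) (g 0)
  ⊗-scaleˡ c f g (suc n) =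
    trans (cong₂ _+_ (*-assoc c (f 0) (g (suc n))) (⊗-scaleˡ c (f ∘ suc) g n))
          (sym (*-distribˡ-+ c _ _))

  ⊗-scaleʳ : ∀ c f g → f ⊗ (c · g) ≗ c · (f ⊗ g)
  ⊗-scaleʳ c f g zero    = x*[y*z]≡y*[x*z] (f 0) c (g 0)
  ⊗-scaleʳ c f g (suc n) =
    trans (cong₂ _+_ (x*[y*z]≡y*[x*z] (f 0) c (g (suc n))) (⊗-scaleʳ c (f ∘ suc) g n))
          (sym (*-distribˡ-+ c _ _))

  ⊗-distribˡ : ∀ f g q → f ⊗ (g ⊕ q) ≗ f ⊗ g ⊕ f ⊗ q
  ⊗-distribˡ f g q zero    = *-distribˡ-+ (f 0) (g 0) (q 0)
  ⊗-distribˡ f g q (suc n) =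
    trans (cong₂ _+_ (*-distribˡ-+ (f 0) (g (suc n)) (q (suc n))) (⊗-distribˡ (f ∘ suc) g q n))
          (+-interchange (f 0 * g (suc n)) (f 0 * q (suc n)) _ _)

  ⊗-distribʳ : ∀ f g q → (f ⊕ g) ⊗ q ≗ f ⊗ q ⊕ g ⊗ q
  ⊗-distribʳ f g q zero    = *-distribʳ-+ (q 0) (f 0) (g 0)
  ⊗-distribʳ f g q (suc n) =
    trans (cong₂ _+_ (*-distribʳ-+ (q (suc n)) (f 0) (g 0)) (⊗-distribʳ (f ∘ suc) (g ∘ suc) q n))
          (+-interchange (f 0 * q (suc n)) (g 0 * q (suc n)) _ _)

  ⊗-peelʳ : ∀ f g n → (f ⊗ g) (suc n) ≡ f (suc n) * g 0 + (f ⊗ (g ∘ suc)) n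
  ⊗-peelʳ f g zero    = +-comm (f 0 * g 1) (f 1 * g 0)
  ⊗-peelʳ f g (suc n) =
    trans (cong (f 0 * g (suc (suc n)) +_) (⊗-peelʳ (f ∘ suc) g n))
          (x+[y+z]≡y+[x+z] (f 0 * g (suc (suc n))) (f (suc (suc n)) * g 0) _)

  ⊗-comm : ∀ f g → f ⊗ g ≗ g ⊗ f
  ⊗-comm f g zero    = *-comm (f 0) (g 0)
  ⊗-comm f g (suc n) =
    trans (cong₂ _+_ (*-comm (f 0) (g (suc n))) (⊗-comm (f ∘ suc) g n)) (sym (⊗-peelʳ g f n))

  ⊗-decompose : ∀ f g → f ⊗ g ≗ f 0 · g ⊕ shift ((f ∘ suc) ⊗ g)
  ⊗-decompose f g zero    = sym (+-identityʳ _)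
  ⊗-decompose f g (suc n) = refl

  ⊗-assoc : ∀ f g q → (f ⊗ g) ⊗ q ≗ f ⊗ (g ⊗ q)
  ⊗-assoc f g q n = begin
    ((f ⊗ g) ⊗ q) n
      ≡⟨ ⊗-congˡ q (⊗-decompose f g) n ⟩
    ((f 0 · g ⊕ shift ((f ∘ suc) ⊗ g)) ⊗ q) n
      ≡⟨ ⊗-distribʳ (f 0 · g) _ q n ⟩
    ((f 0 · g) ⊗ q) n + (shift ((f ∘ suc) ⊗ g) ⊗ q) n
      ≡⟨ cong₂ _+_ (⊗-scaleˡ (f 0) g q n) (⊗-shiftˡ _ q n) ⟩
    f 0 * (g ⊗ q) n + shift (((f ∘ suc) ⊗ g) ⊗ q) n
      ≡⟨ cong (f 0 * (g ⊗ q) n +_) (shifted-assoc n) ⟩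
    f 0 * (g ⊗ q) n + shift ((f ∘ suc) ⊗ (g ⊗ q)) n
      ≡⟨ ⊗-decompose f (g ⊗ q) n ⟨
    (f ⊗ (g ⊗ q)) n
      ∎
    where
    open ≡-Reasoning
    shifted-assoc : ∀ n → shift (((f ∘ suc) ⊗ g) ⊗ q) n ≡ shift ((f ∘ suc) ⊗ (g ⊗ q)) n
    shifted-assoc zero    = refl
    shifted-assoc (suc m) = ⊗-assoc (f ∘ suc) g q m

open PowerSeries

module FirstStepSystems where
  open import Data.Nat using (zero; suc; _+_; _*_; _<_; s≤s; _≡ᵇ_)
  open import Data.Nat.Properties
  open import Data.Bool using (if_then_else_)
  open import Data.List using ([]; _∷_)
  open import Function using (_∘_)
  open import Relation.Binary.PropositionalEquality
  open import Data.Nat.Tactic.RingSolver using (solve)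
  open import Algebra.Properties.CommutativeSemigroup +-commutativeSemigroup using () renaming (interchange to +-interchange)

  δ : ℕ → ℕ → ℕ
  δ ℓ t = if t ≡ᵇ ℓ then 1 else 0

  -- Moves F s collects the contributions of the four possible first steps u, d, h, v
  -- of a path starting at height s, where F t is the series of the paths from height t;
  -- only the vertical step v has width 0.
  Moves : (ℕ → Ser) → ℕ → Ser
  Moves F zero    = shift (F 1) ⊕ shift (F 0)
  Moves F (suc s) = shift (F (suc (suc s))) ⊕ (shift (F s) ⊕ (shift (F (suc s)) ⊕ F s))

  -- A path from height s of width x has at most s + 2x steps, since every v-step is paid
  -- for either by a u-step or by the initial height.
  maxLength : ℕ → ℕ → ℕ
  maxLength s zero    = s
  maxLength s (suc x) = suc (suc (maxLength s x))

  maxLength-suc : ∀ s x → maxLength (suc s) x ≡ suc (maxLength s x)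
  maxLength-suc s zero    = refl
  maxLength-suc s (suc x) = cong (suc ∘ suc) (maxLength-suc s x)

  u< : ∀ s x → maxLength (suc s) x < maxLength s (suc x)
  u< s x = ≤-reflexive (cong suc (maxLength-suc s x))

  h< : ∀ s x → maxLength s x < maxLength s (suc x)
  h< s x = n≤1+n _

  v< : ∀ s x → maxLength s x < maxLength (suc s) x
  v< s x = ≤-reflexive (sym (maxLength-suc s x))

  d< : ∀ s x → maxLength s x < maxLength (suc s) (suc x)
  d< s x = <-trans (v< s x) (h< (suc s) x)

  Moves-cong-< : ∀ {F G} s x → (∀ t y → maxLength t y < maxLength s x → F t y ≡ G t y) →
                 Moves F s x ≡ Moves G s x
  Moves-cong-< zero    zero    F≡G = refl
  Moves-cong-< zero    (suc x) F≡G = cong₂ _+_ (F≡G 1 x (u< 0 x)) (F≡G 0 x (h< 0 x))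
  Moves-cong-< (suc s) zero    F≡G = F≡G s 0 (v< s 0)
  Moves-cong-< (suc s) (suc x) F≡G =
    cong₂ _+_ (F≡G (suc (suc s)) x (u< (suc s) x))
      (cong₂ _+_ (F≡G s x (d< s x))
        (cong₂ _+_ (F≡G (suc s) x (h< (suc s) x)) (F≡G s (suc x) (v< s (suc x)))))

  Moves-⊕ : ∀ F G s → Moves (λ t → F t ⊕ G t) s ≗ Moves F s ⊕ Moves G s
  Moves-⊕ F G zero    zero    = refl
  Moves-⊕ F G zero    (suc x) = +-interchange (F 1 x) (G 1 x) (F 0 x) (G 0 x)
  Moves-⊕ F G (suc s) zero    = refl
  Moves-⊕ F G (suc s) (suc x) =
    regroup (F (suc (suc s)) x) (G (suc (suc s)) x) (F s x) (G s x)
            (F (suc s) x) (G (suc s) x) (F s (suc x)) (G s (suc x))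
    where
    regroup : ∀ a a′ b b′ c c′ e e′ →
              a + a′ + (b + b′ + (c + c′ + (e + e′))) ≡ a + (b + (c + e)) + (a′ + (b′ + (c′ + e′)))
    regroup a a′ b b′ c c′ e e′ = solve (a ∷ a′ ∷ b ∷ b′ ∷ c ∷ c′ ∷ e ∷ e′ ∷ [])

  ⊗-Moves : ∀ A F s → A ⊗ Moves F s ≗ Moves (λ t → A ⊗ F t) s
  ⊗-Moves A F zero x =
    trans (⊗-distribˡ A (shift (F 1)) (shift (F 0)) x)
          (cong₂ _+_ (⊗-shiftʳ A (F 1) x) (⊗-shiftʳ A (F 0) x))
  ⊗-Moves A F (suc s) x =
    trans (⊗-distribˡ A (shift (F (suc (suc s)))) _ x)
      (cong₂ _+_ (⊗-shiftʳ A (F (suc (suc s))) x)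
        (trans (⊗-distribˡ A (shift (F s)) _ x)
          (cong₂ _+_ (⊗-shiftʳ A (F s) x)
            (trans (⊗-distribˡ A (shift (F (suc s))) (F s) x)
              (cong (_+ (A ⊗ F s) x) (⊗-shiftʳ A (F (suc s)) x))))))

  ⊗-system : ∀ A {F} e s → F s ≗ e ⊕ Moves F s → A ⊗ F s ≗ A ⊗ e ⊕ Moves (λ t → A ⊗ F t) s
  ⊗-system A {F} e s F-sys x =
    trans (⊗-congʳ A F-sys x)
          (trans (⊗-distribˡ A e (Moves F s) x) (cong ((A ⊗ e) x +_) (⊗-Moves A F s x)))

  infixr 5 _◃_

  _◃_ : Ser → (ℕ → Ser) → ℕ → Ser
  (Z ◃ F) zero    = Z
  (Z ◃ F) (suc s) = F s

  ◃-Moves : ∀ Z F s → Moves (Z ◃ F) (suc s) ≗ δ 0 s · (Z ⊕ shift Z) ⊕ Moves F s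
  ◃-Moves Z F zero zero = regroup (Z 0)
    where
    regroup : ∀ a → a ≡ 1 * (a + 0) + 0
    regroup a = solve (a ∷ [])
  ◃-Moves Z F zero (suc x) = regroup (F 1 x) (Z x) (F 0 x) (Z (suc x))
    where
    regroup : ∀ a b c e → a + (b + (c + e)) ≡ (e + b + 0) + (a + c)
    regroup a b c e = solve (a ∷ b ∷ c ∷ e ∷ [])
  ◃-Moves Z F (suc s) x = refl

  Moves-unique : ∀ {F G} (e : ℕ → Ser) →
                 (∀ s → F (suc s) ≗ e s ⊕ Moves F (suc s)) →
                 (∀ s → G (suc s) ≗ e s ⊕ Moves G (suc s)) →
                 F 0 ≗ G 0 → ∀ s → F s ≗ G s
  Moves-unique {F} {G} e F-sys G-sys F0≗G0 s x = agree (suc (maxLength s x)) s x ≤-refl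
    where
    agree : ∀ K s x → maxLength s x < K → F s x ≡ G s x
    agree (suc K) zero    x _ = F0≗G0 x
    agree (suc K) (suc s) x (s≤s bound) = begin
      F (suc s) x                       ≡⟨ F-sys s x ⟩
      e s x + Moves F (suc s) x         ≡⟨ cong (e s x +_) (Moves-cong-< (suc s) x λ t y below →
                                             agree K t y (≤-trans below bound)) ⟩
      e s x + Moves G (suc s) x         ≡⟨ G-sys s x ⟨
      G (suc s) x                       ∎
      where open ≡-Reasoning

open FirstStepSystems

module FiniteSums where
  open import Algebra.Bundles using (Semiring)
  import Algebra.Properties.Semiring.Sum as SemiringSum
  open import Data.Nat using (zero; suc; _+_; _*_)
  open import Data.Nat.Properties
  open import Data.Nat.ListAction using (sum)
  open import Data.Nat.ListAction.Properties using (sum-++)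
  open import Data.Bool using (Bool; true; false; if_then_else_)
  open import Data.Bool.Properties using (T?)
  open import Data.Fin using (toℕ)
  open import Data.List using (List; []; _∷_; _++_; map; concatMap; filter; foldr; applyUpTo)
  open import Data.List.Properties using (map-++)
  open import Function using (_∘_)
  open import Relation.Binary.PropositionalEquality
  open import Algebra.Properties.CommutativeSemigroup +-commutativeSemigroup using () renaming (interchange to +-interchange)

  module ℕΣ = SemiringSum +-*-semiring

  module _ {c ℓ} (R : Semiring c ℓ) where
    open Semiring R using (Carrier; 0#; _≈_; +-congˡ) renaming (_+_ to _+ᴿ_; refl to ≈-refl)
    open SemiringSum R using () renaming (sum to ∑ᴿ)

    foldr-map-applyUpTo : ∀ (F : ℕ → Carrier) f n →
      foldr _+ᴿ_ 0# (map F (applyUpTo f n)) ≈ ∑ᴿ {n} (λ i → F (f (toℕ i)))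
    foldr-map-applyUpTo F f zero    = ≈-refl
    foldr-map-applyUpTo F f (suc n) = +-congˡ (foldr-map-applyUpTo F (f ∘ suc) n)

  module _ {A : Set} where

    sum-map-concatMap : ∀ {B : Set} (g : A → ℕ) (f : B → List A) xs →
      sum (map g (concatMap f xs)) ≡ sum (map (λ b → sum (map g (f b))) xs)
    sum-map-concatMap g f []       = refl
    sum-map-concatMap g f (b ∷ xs) = begin
      sum (map g (f b ++ concatMap f xs))
        ≡⟨ cong sum (map-++ g (f b) _) ⟩
      sum (map g (f b) ++ map g (concatMap f xs))
        ≡⟨ sum-++ (map g (f b)) _ ⟩
      sum (map g (f b)) + sum (map g (concatMap f xs))
        ≡⟨ cong (sum (map g (f b)) +_) (sum-map-concatMap g f xs) ⟩
      sum (map g (f b)) + sum (map (λ b → sum (map g (f b))) xs)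
        ∎
      where open ≡-Reasoning

    sum-map-filter : ∀ (p : A → Bool) (g : A → ℕ) xs →
      sum (map g (filter (λ x → T? (p x)) xs)) ≡ sum (map (λ x → if p x then g x else 0) xs)
    sum-map-filter p g []       = refl
    sum-map-filter p g (x ∷ xs) with p x
    ... | true  = cong (g x +_) (sum-map-filter p g xs)
    ... | false = sum-map-filter p g xs

    sum-map-+ : ∀ (f g : A → ℕ) xs → sum (map (λ x → f x + g x) xs) ≡ sum (map f xs) + sum (map g xs)
    sum-map-+ f g []       = refl
    sum-map-+ f g (x ∷ xs) =
      trans (cong (f x + g x +_) (sum-map-+ f g xs)) (+-interchange (f x) (g x) _ _)

    sum-map-* : ∀ c (f : A → ℕ) xs → sum (map (λ x → c * f x) xs) ≡ c * sum (map f xs)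
    sum-map-* c f []       = sym (*-zeroʳ c)
    sum-map-* c f (x ∷ xs) = trans (cong (c * f x +_) (sum-map-* c f xs)) (sym (*-distribˡ-+ c (f x) _))

open FiniteSums

module PathCounts where
  open import Data.Nat using (zero; suc; _+_; _*_; _<_; s≤s; s≤s⁻¹; _≡ᵇ_)
  open import Data.Nat.Properties
  open import Data.Nat.Tactic.RingSolver using (solve)
  open import Data.Nat.ListAction using (sum)
  open import Data.Bool using (Bool; true; false; _∧_; if_then_else_)
  open import Data.Bool.Properties using (∧-zeroʳ; if-eta)
  open import Data.Fin using (toℕ)
  open import Data.List using ([]; _∷_; map; concatMap; upTo)
  open import Data.List.Properties using (map-cong)
  open import Function using (_∘_)
  open import Relation.Binary.PropositionalEquality

  -- pathCount s x counts the paths of width x from height s to the axis, never going below it;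
  -- uStepCount ℓ s x counts their u-steps at level ℓ.
  pathCount : ℕ → Ser
  pathCount zero    zero    = 1
  pathCount zero    (suc x) = pathCount 1 x + pathCount 0 x
  pathCount (suc s) zero    = pathCount s zero
  pathCount (suc s) (suc x) =
    pathCount (suc (suc s)) x + (pathCount s x + (pathCount (suc s) x + pathCount s (suc x)))

  -- the u-steps ending at level ℓ that are the first step of a path from height s
  source : ℕ → ℕ → Ser
  source ℓ s = shift (δ ℓ (suc s) · pathCount (suc s))

  uStepCount : ℕ → ℕ → Ser
  uStepCount ℓ zero    zero    = 0
  uStepCount ℓ zero    (suc x) = δ ℓ 1 * pathCount 1 x + (uStepCount ℓ 1 x + uStepCount ℓ 0 x)
  uStepCount ℓ (suc s) zero    = uStepCount ℓ s zero
  uStepCount ℓ (suc s) (suc x) =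
    δ ℓ (suc (suc s)) * pathCount (suc (suc s)) x +
    (uStepCount ℓ (suc (suc s)) x + (uStepCount ℓ s x + (uStepCount ℓ (suc s) x + uStepCount ℓ s (suc x))))

  pathCount-system : ∀ s → pathCount s ≗ δ 0 s · one ⊕ Moves pathCount s
  pathCount-system zero    zero    = refl
  pathCount-system zero    (suc x) = refl
  pathCount-system (suc s) zero    = refl
  pathCount-system (suc s) (suc x) = refl

  uStepCount-system : ∀ ℓ s → uStepCount ℓ s ≗ source ℓ s ⊕ Moves (uStepCount ℓ) s
  uStepCount-system ℓ zero    zero    = refl
  uStepCount-system ℓ zero    (suc x) = refl
  uStepCount-system ℓ (suc s) zero    = refl
  uStepCount-system ℓ (suc s) (suc x) = refl

  isPath : ℕ → ℕ → Path → Bool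
  isPath s x w = (xlen w ≡ᵇ x) ∧ validFrom s w

  pathIndicator : ℕ → ℕ → Path → ℕ
  pathIndicator s x w = if isPath s x w then 1 else 0

  uStepWeight : ℕ → ℕ → ℕ → Path → ℕ
  uStepWeight ℓ s x w = if isPath s x w then uStepsAtFrom ℓ s w else 0

  sumSteps : (Path → ℕ) → Path → ℕ
  sumSteps g w = g (u ∷ w) + (g (d ∷ w) + (g (h ∷ w) + g (v ∷ w)))

  sumWords : ℕ → (Path → ℕ) → ℕ
  sumWords K g = ℕΣ.sum {K} (λ k → sum (map g (words (toℕ k))))

  sumWords-suc : ∀ K g → sumWords (suc K) g ≡ g [] + sumWords K (sumSteps g)
  sumWords-suc K g = cong₂ _+_ (+-identityʳ (g [])) (ℕΣ.sum-cong-≗ {K} one-more-step)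
    where
    four-steps : ∀ w → sum (map g (map (_∷ w) (u ∷ d ∷ h ∷ v ∷ []))) ≡ sumSteps g w
    four-steps w = cong (λ t → g (u ∷ w) + (g (d ∷ w) + (g (h ∷ w) + t))) (+-identityʳ (g (v ∷ w)))
    one-more-step : ∀ k → sum (map g (words (suc (toℕ k)))) ≡ sum (map (sumSteps g) (words (toℕ k)))
    one-more-step k =
      trans (sum-map-concatMap g _ (words (toℕ k))) (cong sum (map-cong four-steps (words (toℕ k))))

  sumWords-cong : ∀ K {f g} → f ≗ g → sumWords K f ≡ sumWords K g
  sumWords-cong K f≗g = ℕΣ.sum-cong-≗ {K} (λ k → cong sum (map-cong f≗g (words (toℕ k))))

  sumWords-+ : ∀ K f g → sumWords K (λ w → f w + g w) ≡ sumWords K f + sumWords K g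
  sumWords-+ K f g =
    trans (ℕΣ.sum-cong-≗ {K} (λ k → sum-map-+ f g (words (toℕ k))))
          (ℕΣ.∑-distrib-+ {K} (λ k → sum (map f (words (toℕ k)))) _)

  sumWords-* : ∀ K c g → sumWords K (λ w → c * g w) ≡ c * sumWords K g
  sumWords-* K c g =
    trans (ℕΣ.sum-cong-≗ {K} (λ k → sum-map-* c g (words (toℕ k))))
          (sym (ℕΣ.*-distribˡ-sum {K} c (λ k → sum (map g (words (toℕ k))))))

  sumWords-zero : ∀ K → sumWords K (λ _ → 0) ≡ 0
  sumWords-zero K = sumWords-* K 0 (λ _ → 0)

  sumWords-Moves : ∀ K (G : Path → ℕ → Ser) s x →
    sumWords K (λ w → Moves (G w) s x) ≡ Moves (λ t y → sumWords K (λ w → G w t y)) s x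
  sumWords-Moves K G zero    zero    = sumWords-zero K
  sumWords-Moves K G zero    (suc x) = sumWords-+ K (λ w → G w 1 x) (λ w → G w 0 x)
  sumWords-Moves K G (suc s) zero    = refl
  sumWords-Moves K G (suc s) (suc x) =
    trans (sumWords-+ K (λ w → G w (suc (suc s)) x) _)
      (cong (sumWords K (λ w → G w (suc (suc s)) x) +_)
        (trans (sumWords-+ K (λ w → G w s x) _)
          (cong (sumWords K (λ w → G w s x) +_) (sumWords-+ K (λ w → G w (suc s) x) (λ w → G w s (suc x))))))

  -- Grouping words by their first step turns sums over words into solutions of first-step systems.
  sumWords≡solution :
    ∀ (ω I : ℕ → ℕ → Path → ℕ) (J T : ℕ → Ser) →
    (∀ s x w → sumSteps (ω s x) w ≡ I s x w + Moves (λ t y → ω t y w) s x) →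
    (∀ s → T s ≗ J s ⊕ Moves T s) →
    (∀ K s x → maxLength s x < suc K → ω s x [] + sumWords K (I s x) ≡ J s x) →
    ∀ K s x → maxLength s x < K → sumWords K (ω s x) ≡ T s x
  sumWords≡solution ω I J T step T-sys extra (suc K) s x (s≤s bound) = begin
    sumWords (suc K) (ω s x)
      ≡⟨ sumWords-suc K (ω s x) ⟩
    ω s x [] + sumWords K (sumSteps (ω s x))
      ≡⟨ cong (ω s x [] +_) (trans (sumWords-cong K (step s x)) (sumWords-+ K (I s x) _)) ⟩
    ω s x [] + (ΣI + sumWords K (λ w → Moves (λ t y → ω t y w) s x))
      ≡⟨ cong (λ m → ω s x [] + (ΣI + m))
              (trans (sumWords-Moves K (λ w t y → ω t y w) s x) (Moves-cong-< s x shorter)) ⟩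
    ω s x [] + (ΣI + Moves T s x)
      ≡⟨ +-assoc (ω s x []) ΣI (Moves T s x) ⟨
    ω s x [] + ΣI + Moves T s x
      ≡⟨ cong (_+ Moves T s x) (extra K s x (s≤s bound)) ⟩
    J s x + Moves T s x
      ≡⟨ T-sys s x ⟨
    T s x
      ∎
    where
    open ≡-Reasoning
    ΣI = sumWords K (I s x)
    shorter : ∀ t y → maxLength t y < maxLength s x → sumWords K (ω t y) ≡ T t y
    shorter t y below = sumWords≡solution ω I J T step T-sys extra K t y (≤-trans below bound)

  pathIndicator-steps : ∀ s x w → sumSteps (pathIndicator s x) w ≡ Moves (λ t y → pathIndicator t y w) s x
  pathIndicator-steps zero    zero    w rewrite ∧-zeroʳ (xlen w ≡ᵇ 0) = refl
  pathIndicator-steps zero    (suc x) w rewrite ∧-zeroʳ (xlen w ≡ᵇ x) | ∧-zeroʳ (xlen w ≡ᵇ suc x) =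
    cong (pathIndicator 1 x w +_) (+-identityʳ (pathIndicator 0 x w))
  pathIndicator-steps (suc s) zero    w = refl
  pathIndicator-steps (suc s) (suc x) w = refl

  if-+ : ∀ b a c → (if b then a + c else 0) ≡ a * (if b then 1 else 0) + (if b then c else 0)
  if-+ true  a c = cong (_+ c) (sym (*-identityʳ a))
  if-+ false a c = sym (trans (+-identityʳ (a * 0)) (*-zeroʳ a))

  uStepWeight-steps : ∀ ℓ s x w →
    sumSteps (uStepWeight ℓ s x) w ≡
    shift (δ ℓ (suc s) · (λ y → pathIndicator (suc s) y w)) x + Moves (λ t y → uStepWeight ℓ t y w) s x
  uStepWeight-steps ℓ zero    zero    w rewrite ∧-zeroʳ (xlen w ≡ᵇ 0) = refl
  uStepWeight-steps ℓ zero    (suc x) w rewrite ∧-zeroʳ (xlen w ≡ᵇ x) | ∧-zeroʳ (xlen w ≡ᵇ suc x) =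
    trans (cong₂ _+_ (if-+ (isPath 1 x w) (δ ℓ 1) (uStepsAtFrom ℓ 1 w)) (+-identityʳ (uStepWeight ℓ 0 x w)))
          (+-assoc (δ ℓ 1 * pathIndicator 1 x w) _ _)
  uStepWeight-steps ℓ (suc s) zero    w = refl
  uStepWeight-steps ℓ (suc s) (suc x) w =
    trans (cong (_+ (uStepWeight ℓ s x w + (uStepWeight ℓ (suc s) x w + uStepWeight ℓ s (suc x) w)))
                (if-+ (isPath (suc (suc s)) x w) (δ ℓ (suc (suc s))) (uStepsAtFrom ℓ (suc (suc s)) w)))
          (+-assoc (δ ℓ (suc (suc s)) * pathIndicator (suc (suc s)) x w) _ _)

  sumWords-pathIndicator : ∀ K s x → maxLength s x < K → sumWords K (pathIndicator s x) ≡ pathCount s x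
  sumWords-pathIndicator =
    sumWords≡solution pathIndicator (λ _ _ _ → 0) (λ s → δ 0 s · one) pathCount
      pathIndicator-steps pathCount-system
      (λ K s x _ → trans (cong (pathIndicator s x [] +_) (sumWords-zero K)) (empty-word s x))
    where
    empty-word : ∀ s x → pathIndicator s x [] + 0 ≡ δ 0 s * one x
    empty-word zero    zero    = refl
    empty-word zero    (suc x) = refl
    empty-word (suc s) zero    = refl
    empty-word (suc s) (suc x) = refl

  sumWords-uStepWeight : ∀ ℓ K s x → maxLength s x < K → sumWords K (uStepWeight ℓ s x) ≡ uStepCount ℓ s x
  sumWords-uStepWeight ℓ =
    sumWords≡solution (uStepWeight ℓ) (λ s x w → shift (δ ℓ (suc s) · (λ y → pathIndicator (suc s) y w)) x)
      (source ℓ) (uStepCount ℓ) (uStepWeight-steps ℓ) (uStepCount-system ℓ) extra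
    where
    extra : ∀ K s x → maxLength s x < suc K →
            uStepWeight ℓ s x [] + sumWords K (λ w → shift (δ ℓ (suc s) · (λ y → pathIndicator (suc s) y w)) x) ≡
            source ℓ s x
    extra K s zero    _     = cong₂ _+_ (if-eta (isPath s 0 [])) (sumWords-zero K)
    extra K s (suc y) bound =
      cong₂ _+_ (if-eta (isPath s (suc y) []))
        (trans (sumWords-* K (δ ℓ (suc s)) (pathIndicator (suc s) y))
               (cong (δ ℓ (suc s) *_) (sumWords-pathIndicator K (suc s) y (<-≤-trans (u< s y) (s≤s⁻¹ bound)))))

  maxLength-closed : ∀ s x → maxLength s x ≡ s + 2 * x
  maxLength-closed s zero    = sym (+-identityʳ s)
  maxLength-closed s (suc x) = trans (cong (suc ∘ suc) (maxLength-closed s x)) (two-more s x)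
    where
    two-more : ∀ s x → suc (suc (s + 2 * x)) ≡ s + 2 * suc x
    two-more s x = solve (s ∷ x ∷ [])

  α≡uStepCount : ∀ N i → α N i ≡ uStepCount (suc i) 0 (suc N)
  α≡uStepCount N i = begin
    α N i
      ≡⟨ sum-map-filter (isGMotzkin? (suc N)) (uStepsAt (suc i)) allWords ⟩
    sum (map weight allWords)
      ≡⟨ sum-map-concatMap weight words (upTo (suc L)) ⟩
    sum (map (λ k → sum (map weight (words k))) (upTo (suc L)))
      ≡⟨ foldr-map-applyUpTo +-*-semiring (λ k → sum (map weight (words k))) (λ k → k) (suc L) ⟩
    sumWords (suc L) weight
      ≡⟨ sumWords-uStepWeight (suc i) (suc L) 0 (suc N) bound ⟩
    uStepCount (suc i) 0 (suc N)
      ∎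
    where
    open ≡-Reasoning
    L = 2 * suc N
    allWords = concatMap words (upTo (suc L))
    weight = uStepWeight (suc i) 0 (suc N)
    bound : maxLength 0 (suc N) < suc L
    bound = ≤-reflexive (cong suc (maxLength-closed 0 (suc N)))

open PathCounts

module GeneratingFunctions where
  open import Data.Nat using (zero; suc; _+_; _*_; _∸_; _≤_; _<_; s≤s; s≤s⁻¹)
  open import Data.Nat.Properties
  open import Data.Nat.Tactic.RingSolver using (solve)
  open import Data.List using ([]; _∷_)
  open import Function using (_∘_)
  open import Data.Fin using (toℕ)
  open import Relation.Binary.PropositionalEquality

  infix 8 _⁺

  _⁺ : Ser → Ser
  f ⁺ = f ⊕ shift f

  ⊗-scaled-one : ∀ A c → A ⊗ (c · one) ≗ c · A
  ⊗-scaled-one A c x = trans (⊗-scaleʳ c A one x) (cong (c *_) (⊗-identityʳ A x))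

  M R K : Ser
  M = pathCount 0
  R = M ⁺
  K = R ⊗ M

  -- A path from height s + 1 first touches the axis by a d- or v-step from height 1; before that
  -- it is a path from height s lifted by one, after it a G-Motzkin path.
  pathCount-suc : ∀ s → pathCount (suc s) ≗ R ⊗ pathCount s
  pathCount-suc =
    Moves-unique (λ _ _ → 0) (λ s → pathCount-system (suc s)) lifted-system (λ _ → refl) ∘ suc
    where
    lifted-system : ∀ s → R ⊗ pathCount s ≗ (λ _ → 0) ⊕ Moves (M ◃ (λ t → R ⊗ pathCount t)) (suc s)
    lifted-system s x = begin
      (R ⊗ pathCount s) x
        ≡⟨ ⊗-system R (δ 0 s · one) s (pathCount-system s) x ⟩
      (R ⊗ (δ 0 s · one)) x + Moves (λ t → R ⊗ pathCount t) s x
        ≡⟨ cong (_+ Moves (λ t → R ⊗ pathCount t) s x) (⊗-scaled-one R (δ 0 s) x) ⟩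
      δ 0 s * R x + Moves (λ t → R ⊗ pathCount t) s x
        ≡⟨ ◃-Moves M (λ t → R ⊗ pathCount t) s x ⟨
      Moves (M ◃ (λ t → R ⊗ pathCount t)) (suc s) x
        ∎
      where open ≡-Reasoning

  -- The same decomposition: a u-step at level ℓ + 1 lies either in the lifted path from height s,
  -- where it is at level ℓ, or in the final G-Motzkin path.
  uStepCount-suc : ∀ ℓ s →
    uStepCount (suc ℓ) (suc s) ≗ R ⊗ uStepCount ℓ s ⊕ (uStepCount (suc ℓ) 0)⁺ ⊗ pathCount s
  uStepCount-suc ℓ =
    Moves-unique (source (suc ℓ) ∘ suc) (λ s → uStepCount-system (suc ℓ) (suc s)) W-system (λ _ → refl) ∘ suc
    where
    Z = uStepCount (suc ℓ) 0
    W : ℕ → Ser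
    W t = R ⊗ uStepCount ℓ t ⊕ Z ⁺ ⊗ pathCount t

    R-source : ∀ s → R ⊗ source ℓ s ≗ source (suc ℓ) (suc s)
    R-source s x =
      trans (⊗-shiftʳ R _ x)
            (shift-cong (λ y → trans (⊗-scaleʳ (δ ℓ (suc s)) R (pathCount (suc s)) y)
                                     (cong (δ ℓ (suc s) *_) (sym (pathCount-suc (suc s) y)))) x)

    W-system : ∀ s → W s ≗ source (suc ℓ) (suc s) ⊕ Moves (Z ◃ W) (suc s)
    W-system s x = begin
      (R ⊗ uStepCount ℓ s) x + (Z ⁺ ⊗ pathCount s) x
        ≡⟨ cong₂ _+_ (⊗-system R (source ℓ s) s (uStepCount-system ℓ s) x)
                     (⊗-system (Z ⁺) (δ 0 s · one) s (pathCount-system s) x) ⟩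
      (R ⊗ source ℓ s) x + MU + ((Z ⁺ ⊗ (δ 0 s · one)) x + MP)
        ≡⟨ cong₂ (λ a b → a + MU + (b + MP)) (R-source s x) (⊗-scaled-one (Z ⁺) (δ 0 s) x) ⟩
      source (suc ℓ) (suc s) x + MU + (δ 0 s * (Z ⁺) x + MP)
        ≡⟨ regroup (source (suc ℓ) (suc s) x) MU (δ 0 s * (Z ⁺) x) MP ⟩
      source (suc ℓ) (suc s) x + (δ 0 s * (Z ⁺) x + (MU + MP))
        ≡⟨ cong (λ m → source (suc ℓ) (suc s) x + (δ 0 s * (Z ⁺) x + m))
                (Moves-⊕ (λ t → R ⊗ uStepCount ℓ t) _ s x) ⟨
      source (suc ℓ) (suc s) x + (δ 0 s * (Z ⁺) x + Moves W s x)
        ≡⟨ cong (source (suc ℓ) (suc s) x +_) (◃-Moves Z W s x) ⟨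
      source (suc ℓ) (suc s) x + Moves (Z ◃ W) (suc s) x
        ∎
      where
      open ≡-Reasoning
      MU = Moves (λ t → R ⊗ uStepCount ℓ t) s x
      MP = Moves (λ t → Z ⁺ ⊗ pathCount t) s x
      regroup : ∀ a b c e → a + b + (c + e) ≡ a + (c + (b + e))
      regroup a b c e = solve (a ∷ b ∷ c ∷ e ∷ [])

  ⁺-cong : ∀ {f g} → f ≗ g → f ⁺ ≗ g ⁺
  ⁺-cong f≗g x = cong₂ _+_ (f≗g x) (shift-cong f≗g x)

  ⁺-⊗ : ∀ f g → f ⁺ ⊗ g ≗ (f ⊗ g) ⁺
  ⁺-⊗ f g x = trans (⊗-distribʳ f (shift f) g x) (cong ((f ⊗ g) x +_) (⊗-shiftˡ f g x))

  ⁺-⊗-swap : ∀ f g → f ⁺ ⊗ g ≗ g ⁺ ⊗ f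
  ⁺-⊗-swap f g x = trans (⁺-⊗ f g x) (trans (⁺-cong (⊗-comm f g) x) (sym (⁺-⊗ g f x)))

  shift-fixpoint-unique : ∀ A B {F G} →
    F ≗ shift (A ⊕ B ⊗ F ⊕ F) → G ≗ shift (A ⊕ B ⊗ G ⊕ G) → F ≗ G
  shift-fixpoint-unique A B {F} {G} F-eq G-eq k = agree k k ≤-refl
    where
    agree : ∀ n k → k ≤ n → F k ≡ G k
    agree n       zero    _         = trans (F-eq 0) (sym (G-eq 0))
    agree (suc n) (suc k) (s≤s k≤n) =
      trans (F-eq (suc k))
        (trans (cong₂ (λ p q → A k + p + q)
                      (⊗-congʳ-≤ B k (λ i i≤k → agree n i (≤-trans i≤k k≤n))) (agree n k k≤n))
               (sym (G-eq (suc k))))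

  K-system : K ≗ R ⊕ (shift (R ⊗ K) ⊕ shift K)
  K-system x = begin
    (R ⊗ M) x
      ≡⟨ ⊗-congʳ R M-system x ⟩
    (R ⊗ (one ⊕ (shift K ⊕ shift M))) x
      ≡⟨ ⊗-distribˡ R one _ x ⟩
    (R ⊗ one) x + (R ⊗ (shift K ⊕ shift M)) x
      ≡⟨ cong₂ _+_ (⊗-identityʳ R x) (⊗-distribˡ R (shift K) (shift M) x) ⟩
    R x + ((R ⊗ shift K) x + (R ⊗ shift M) x)
      ≡⟨ cong (R x +_) (cong₂ _+_ (⊗-shiftʳ R K x) (⊗-shiftʳ R M x)) ⟩
    R x + (shift (R ⊗ K) x + shift K x)
      ∎
    where
    open ≡-Reasoning
    M-system : M ≗ one ⊕ (shift K ⊕ shift M)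
    M-system x = trans (pathCount-system 0 x)
      (cong₂ _+_ (*-identityˡ (one x)) (cong (_+ shift M x) (shift-cong (pathCount-suc 0) x)))

  -- Z and z K Y both solve F = z (R Y + R F + F); for Z, split off the first step (h, or u to
  -- level 1 < j + 2) and apply uStepCount-suc.
  uStepCount-level : ∀ j → uStepCount (suc (suc j)) 0 ≗ shift (K ⊗ uStepCount (suc j) 0)
  uStepCount-level j = shift-fixpoint-unique (R ⊗ Y) R Z-system X-system
    where
    Y = uStepCount (suc j) 0
    Z = uStepCount (suc (suc j)) 0

    Z-system : Z ≗ shift (R ⊗ Y ⊕ R ⊗ Z ⊕ Z)
    Z-system zero    = refl
    Z-system (suc x) =
      cong (_+ Z x) (trans (uStepCount-suc (suc j) 0 x) (cong ((R ⊗ Y) x +_) (⁺-⊗-swap Z M x)))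

    X-system : shift (K ⊗ Y) ≗ shift (R ⊗ Y ⊕ R ⊗ shift (K ⊗ Y) ⊕ shift (K ⊗ Y))
    X-system = shift-cong λ x → begin
      (K ⊗ Y) x
        ≡⟨ ⊗-congˡ Y K-system x ⟩
      ((R ⊕ (shift (R ⊗ K) ⊕ shift K)) ⊗ Y) x
        ≡⟨ ⊗-distribʳ R _ Y x ⟩
      (R ⊗ Y) x + ((shift (R ⊗ K) ⊕ shift K) ⊗ Y) x
        ≡⟨ cong ((R ⊗ Y) x +_) (⊗-distribʳ (shift (R ⊗ K)) (shift K) Y x) ⟩
      (R ⊗ Y) x + ((shift (R ⊗ K) ⊗ Y) x + (shift K ⊗ Y) x)
        ≡⟨ cong ((R ⊗ Y) x +_) (cong₂ _+_ (⊗-shiftˡ (R ⊗ K) Y x) (⊗-shiftˡ K Y x)) ⟩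
      (R ⊗ Y) x + (shift ((R ⊗ K) ⊗ Y) x + shift (K ⊗ Y) x)
        ≡⟨ cong (λ p → (R ⊗ Y) x + (p + shift (K ⊗ Y) x)) (shift-cong (⊗-assoc R K Y) x) ⟩
      (R ⊗ Y) x + (shift (R ⊗ (K ⊗ Y)) x + shift (K ⊗ Y) x)
        ≡⟨ cong (λ p → (R ⊗ Y) x + (p + shift (K ⊗ Y) x)) (⊗-shiftʳ R (K ⊗ Y) x) ⟨
      (R ⊗ Y) x + ((R ⊗ shift (K ⊗ Y)) x + shift (K ⊗ Y) x)
        ≡⟨ +-assoc ((R ⊗ Y) x) _ _ ⟨
      (R ⊗ Y) x + (R ⊗ shift (K ⊗ Y)) x + shift (K ⊗ Y) x
        ∎
      where open ≡-Reasoning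

  uStepCount-vanish : ∀ k x → x ≤ k → uStepCount (suc k) 0 x ≡ 0
  uStepCount-vanish k       zero    _         = refl
  uStepCount-vanish (suc k) (suc x) (s≤s x≤k) =
    trans (uStepCount-level k (suc x))
          (⊗-zeroʳ-≤ K _ x (λ i i≤x → uStepCount-vanish k i (≤-trans i≤x x≤k)))

  ⊗-support : ∀ f g s e → (∀ x → x < s → g x ≡ 0) → (f ⊗ g) (e + s) ≡ (f ⊗ (λ y → g (y + s))) e
  ⊗-support f g zero    zero    g≡0 = refl
  ⊗-support f g (suc s) zero    g≡0 =
    trans (cong (f 0 * g (suc s) +_) (⊗-zeroʳ-≤ (f ∘ suc) g s (λ k k≤s → g≡0 k (s≤s k≤s))))
          (+-identityʳ _)
  ⊗-support f g s       (suc e) g≡0 = cong (f 0 * g (suc e + s) +_) (⊗-support (f ∘ suc) g s e g≡0)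

  ⊗-as-sum : ∀ f g n → (f ⊗ g) n ≡ ℕΣ.sum {suc n} (λ t → f (toℕ t) * g (n ∸ toℕ t))
  ⊗-as-sum f g zero    = sym (+-identityʳ _)
  ⊗-as-sum f g (suc n) = cong (f 0 * g (suc n) +_) (⊗-as-sum (f ∘ suc) g n)

  -- β e k = α (e + k) k, the u-steps at level k + 1 indexed by the excess e of the length
  β : ℕ → ℕ → ℕ
  β e k = uStepCount (suc k) 0 (e + suc k)

  α≡β : ∀ n m i → α (n + m + i) (m + i) ≡ β n (m + i)
  α≡β n m i = trans (α≡uStepCount (n + m + i) (m + i)) (cong (uStepCount (suc (m + i)) 0) (reassoc n m i))
    where
    reassoc : ∀ n m i → suc (n + m + i) ≡ n + suc (m + i)
    reassoc n m i = solve (n ∷ m ∷ i ∷ [])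

  K₁≡5 : K 1 ≡ 5
  K₁≡5 = refl

  β-suc : ∀ e k → β e (suc k) ≡ β e k + ℕΣ.sum {e} (λ t → K (suc (toℕ t)) * β (e ∸ suc (toℕ t)) k)
  β-suc e k = begin
    uStepCount (suc (suc k)) 0 (e + suc (suc k))
      ≡⟨ cong (uStepCount (suc (suc k)) 0) (+-suc e (suc k)) ⟩
    uStepCount (suc (suc k)) 0 (suc (e + suc k))
      ≡⟨ uStepCount-level k (suc (e + suc k)) ⟩
    (K ⊗ uStepCount (suc k) 0) (e + suc k)
      ≡⟨ ⊗-support K _ (suc k) e (λ x x≤k → uStepCount-vanish k x (s≤s⁻¹ x≤k)) ⟩
    (K ⊗ (λ y → β y k)) e
      ≡⟨ ⊗-as-sum K (λ y → β y k) e ⟩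
    K 0 * β e k + later
      ≡⟨ cong (_+ later) (*-identityˡ (β e k)) ⟩
    β e k + later
      ∎
    where
    open ≡-Reasoning
    later = ℕΣ.sum {e} (λ t → K (suc (toℕ t)) * β (e ∸ suc (toℕ t)) k)

  β-zero : ∀ k → β 0 k ≡ 1
  β-zero zero    = refl
  β-zero (suc k) = trans (β-suc 0 k) (trans (+-identityʳ (β 0 k)) (β-zero k))

open GeneratingFunctions

module FiniteDifferences where
  import Algebra.Properties.Semiring.Sum as SemiringSum
  open import Data.Nat as ℕ using (zero; suc; _∸_; _<_)
  import Data.Nat.Properties as ℕ
  open import Data.Nat.Combinatorics using (_C_; k>n⇒nCk≡0; nCk+nC[k+1]≡[n+1]C[k+1])
  open import Data.Integer as ℤ using (ℤ; +_; -_; _+_; _*_; _-_)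
  open import Data.Integer.Properties
  open import Data.Integer.Tactic.RingSolver using (solve-∀)
  open import Data.Fin using (Fin; toℕ; inject₁; fromℕ) renaming (zero to fzero; suc to fsuc)
  open import Data.Fin.Properties using (toℕ<n; toℕ-inject₁; toℕ-fromℕ)
  open import Function using (_∘_)
  open import Relation.Binary.PropositionalEquality
  open import Algebra.Properties.CommutativeSemigroup ℕ.*-commutativeSemigroup using () renaming (x∙yz≈y∙xz to ℕ-x*[y*z]≡y*[x*z])
  open import Algebra.Properties.CommutativeSemigroup *-commutativeSemigroup using () renaming (x∙yz≈y∙xz to ℤ-x*[y*z]≡y*[x*z])

  module ℤΣ = SemiringSum +-*-semiring

  ∑-neg : ∀ n (F : Fin n → ℤ) → ℤΣ.sum (λ i → - F i) ≡ - ℤΣ.sum F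
  ∑-neg zero    F = refl
  ∑-neg (suc n) F = trans (cong (_+_ (- F fzero)) (∑-neg n (F ∘ fsuc))) (sym (neg-distrib-+ (F fzero) _))

  Δ-term : ℕ → (ℕ → ℕ) → ℕ → ℕ → ℤ
  Δ-term n g m i = signPow (n ∸ i) * + ((n C i) ℕ.* g (m ℕ.+ i))

  Δ : ℕ → (ℕ → ℕ) → ℕ → ℤ
  Δ n g m = ℤΣ.sum {suc n} (λ i → Δ-term n g m (toℕ i))

  lhs≡Δ : ∀ n m → lhs n m ≡ Δ n (β n) m
  lhs≡Δ n m =
    trans (foldr-map-applyUpTo +-*-semiring
             (λ i → signPow (n ∸ i) * + ((n C i) ℕ.* α (n ℕ.+ m ℕ.+ i) (m ℕ.+ i))) (λ i → i) (suc n))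
          (ℤΣ.sum-cong-≗ {suc n} λ i →
             cong (λ a → signPow (n ∸ toℕ i) * + ((n C toℕ i) ℕ.* a)) (α≡β n m (toℕ i)))

  Δ-suc : ∀ n g m → Δ (suc n) g m ≡ Δ n g (suc m) - Δ n g m
  Δ-suc n g m = begin
    Δ (suc n) g m
      ≡⟨⟩
    Δ-term (suc n) g m 0 + ℤΣ.sum {suc n} (λ i → Δ-term (suc n) g m (suc (toℕ i)))
      ≡⟨ cong₂ _+_ (sym (neg-distribˡ-* (signPow n) _))
                   (trans (ℤΣ.sum-cong-≗ {suc n} (pascal ∘ toℕ)) (ℤΣ.∑-distrib-+ {suc n} (A ∘ toℕ) (G ∘ toℕ))) ⟩
    - t₀ + (Δ n g (suc m) + ℤΣ.sum {suc n} (G ∘ toℕ))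
      ≡⟨ cong (λ s → - t₀ + (Δ n g (suc m) + s)) G-sum ⟩
    - t₀ + (Δ n g (suc m) + - ℤΣ.sum {n} (λ i → Δ-term n g m (suc (toℕ i))))
      ≡⟨ rearrange t₀ (Δ n g (suc m)) (ℤΣ.sum {n} (λ i → Δ-term n g m (suc (toℕ i)))) ⟩
    Δ n g (suc m) - Δ n g m
      ∎
    where
    open ≡-Reasoning
    t₀ = Δ-term n g m 0
    A G : ℕ → ℤ
    A = Δ-term n g (suc m)
    G i = signPow (n ∸ i) * + ((n C suc i) ℕ.* g (m ℕ.+ suc i))

    pascal : ∀ i → Δ-term (suc n) g m (suc i) ≡ A i + G i
    pascal i = begin
      signPow (n ∸ i) * + ((suc n C suc i) ℕ.* g (m ℕ.+ suc i))
        ≡⟨ cong (λ c → signPow (n ∸ i) * + (c ℕ.* g (m ℕ.+ suc i))) (sym (nCk+nC[k+1]≡[n+1]C[k+1] n i)) ⟩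
      signPow (n ∸ i) * + (((n C i) ℕ.+ (n C suc i)) ℕ.* g (m ℕ.+ suc i))
        ≡⟨ cong (λ c → signPow (n ∸ i) * + c) (ℕ.*-distribʳ-+ (g (m ℕ.+ suc i)) (n C i) (n C suc i)) ⟩
      signPow (n ∸ i) * + ((n C i) ℕ.* g (m ℕ.+ suc i) ℕ.+ (n C suc i) ℕ.* g (m ℕ.+ suc i))
        ≡⟨ trans (cong (signPow (n ∸ i) *_)
                       (pos-+ ((n C i) ℕ.* g (m ℕ.+ suc i)) ((n C suc i) ℕ.* g (m ℕ.+ suc i))))
                 (*-distribˡ-+ (signPow (n ∸ i)) _ _) ⟩
      signPow (n ∸ i) * + ((n C i) ℕ.* g (m ℕ.+ suc i)) + G i
        ≡⟨ cong (λ k → signPow (n ∸ i) * + ((n C i) ℕ.* g k) + G i) (ℕ.+-suc m i) ⟩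
      A i + G i
        ∎

    G-sum : ℤΣ.sum {suc n} (G ∘ toℕ) ≡ - ℤΣ.sum {n} (λ i → Δ-term n g m (suc (toℕ i)))
    G-sum = begin
      ℤΣ.sum {suc n} (G ∘ toℕ)
        ≡⟨ ℤΣ.sum-init-last {n} (G ∘ toℕ) ⟩
      ℤΣ.sum {n} (G ∘ toℕ ∘ inject₁) + G (toℕ (fromℕ n))
        ≡⟨ cong₂ _+_ (ℤΣ.sum-cong-≗ {n} below-n) top-vanishes ⟩
      ℤΣ.sum {n} (λ i → - Δ-term n g m (suc (toℕ i))) + + 0
        ≡⟨ +-identityʳ _ ⟩
      ℤΣ.sum {n} (λ i → - Δ-term n g m (suc (toℕ i)))
        ≡⟨ ∑-neg n (λ i → Δ-term n g m (suc (toℕ i))) ⟩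
      - ℤΣ.sum {n} (λ i → Δ-term n g m (suc (toℕ i)))
        ∎
      where
      below-n : ∀ (i : Fin n) → G (toℕ (inject₁ i)) ≡ - Δ-term n g m (suc (toℕ i))
      below-n i = begin
        G (toℕ (inject₁ i))                      ≡⟨ cong G (toℕ-inject₁ i) ⟩
        signPow (n ∸ toℕ i) * X                  ≡⟨ cong (λ k → signPow k * X) (ℕ.+-∸-assoc 1 (toℕ<n i)) ⟩
        - signPow (n ∸ suc (toℕ i)) * X          ≡⟨ neg-distribˡ-* (signPow (n ∸ suc (toℕ i))) X ⟨
        - Δ-term n g m (suc (toℕ i))             ∎
        where X = + ((n C suc (toℕ i)) ℕ.* g (m ℕ.+ suc (toℕ i)))
      top-vanishes : G (toℕ (fromℕ n)) ≡ + 0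
      top-vanishes = begin
        G (toℕ (fromℕ n))
          ≡⟨ cong G (toℕ-fromℕ n) ⟩
        signPow (n ∸ n) * + ((n C suc n) ℕ.* g (m ℕ.+ suc n))
          ≡⟨ cong (λ c → signPow (n ∸ n) * + (c ℕ.* g (m ℕ.+ suc n))) (k>n⇒nCk≡0 (ℕ.n<1+n n)) ⟩
        signPow (n ∸ n) * + 0
          ≡⟨ *-zeroʳ (signPow (n ∸ n)) ⟩
        + 0
          ∎

    rearrange : ∀ a b c → - a + (b + - c) ≡ b - (a + c)
    rearrange = solve-∀

  Δ-cong : ∀ n {f g} m → (∀ k → f k ≡ g k) → Δ n f m ≡ Δ n g m
  Δ-cong n m f≡g = ℤΣ.sum-cong-≗ {suc n} λ i →
    cong (λ a → signPow (n ∸ toℕ i) * + ((n C toℕ i) ℕ.* a)) (f≡g (m ℕ.+ toℕ i))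

  Δ-+ : ∀ n f g m → Δ n (λ k → f k ℕ.+ g k) m ≡ Δ n f m + Δ n g m
  Δ-+ n f g m =
    trans (ℤΣ.sum-cong-≗ {suc n} (split ∘ toℕ)) (ℤΣ.∑-distrib-+ {suc n} (Δ-term n f m ∘ toℕ) (Δ-term n g m ∘ toℕ))
    where
    split : ∀ i → Δ-term n (λ k → f k ℕ.+ g k) m i ≡ Δ-term n f m i + Δ-term n g m i
    split i = trans (cong (signPow (n ∸ i) *_)
                          (trans (cong +_ (ℕ.*-distribˡ-+ (n C i) (f (m ℕ.+ i)) (g (m ℕ.+ i))))
                                 (pos-+ ((n C i) ℕ.* f (m ℕ.+ i)) ((n C i) ℕ.* g (m ℕ.+ i)))))
                    (*-distribˡ-+ (signPow (n ∸ i)) _ _)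

  Δ-* : ∀ n c g m → Δ n (λ k → c ℕ.* g k) m ≡ + c * Δ n g m
  Δ-* n c g m =
    trans (ℤΣ.sum-cong-≗ {suc n} (scale ∘ toℕ)) (sym (ℤΣ.*-distribˡ-sum {suc n} (+ c) (Δ-term n g m ∘ toℕ)))
    where
    scale : ∀ i → Δ-term n (λ k → c ℕ.* g k) m i ≡ + c * Δ-term n g m i
    scale i = begin
      signPow (n ∸ i) * + ((n C i) ℕ.* (c ℕ.* g (m ℕ.+ i)))
        ≡⟨ cong (λ k → signPow (n ∸ i) * + k) (ℕ-x*[y*z]≡y*[x*z] (n C i) c _) ⟩
      signPow (n ∸ i) * + (c ℕ.* ((n C i) ℕ.* g (m ℕ.+ i)))
        ≡⟨ cong (signPow (n ∸ i) *_) (pos-* c _) ⟩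
      signPow (n ∸ i) * (+ c * + ((n C i) ℕ.* g (m ℕ.+ i)))
        ≡⟨ ℤ-x*[y*z]≡y*[x*z] (signPow (n ∸ i)) (+ c) _ ⟩
      + c * Δ-term n g m i
        ∎
      where open ≡-Reasoning

  Δ-zero : ∀ n m → Δ n (λ _ → 0) m ≡ + 0
  Δ-zero n m = Δ-* n 0 (λ _ → 0) m

  Δ-∑ : ∀ n e (g : Fin e → ℕ → ℕ) m → Δ n (λ k → ℕΣ.sum (λ t → g t k)) m ≡ ℤΣ.sum (λ t → Δ n (g t) m)
  Δ-∑ n zero    g m = Δ-zero n m
  Δ-∑ n (suc e) g m =
    trans (Δ-+ n (g fzero) (λ k → ℕΣ.sum (λ t → g (fsuc t) k)) m)
          (cong (_+_ (Δ n (g fzero) m)) (Δ-∑ n e (g ∘ fsuc) m))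

  ∑-zero : ∀ k (F : Fin k → ℤ) → (∀ i → F i ≡ + 0) → ℤΣ.sum F ≡ + 0
  ∑-zero k F F≡0 = trans (ℤΣ.sum-cong-≗ {k} F≡0) (ℤΣ.sum-replicate-zero k)

  Δ-β-suc : ∀ n e m → Δ (suc n) (β e) m ≡ ℤΣ.sum {e} (λ t → + K (suc (toℕ t)) * Δ n (β (e ∸ suc (toℕ t))) m)
  Δ-β-suc n e m = begin
    Δ (suc n) (β e) m
      ≡⟨ Δ-suc n (β e) m ⟩
    Δ n (λ k → β e (suc k)) m - Δ n (β e) m
      ≡⟨ cong (_- Δ n (β e) m) (Δ-cong n m (β-suc e)) ⟩
    Δ n (λ k → β e k ℕ.+ later k) m - Δ n (β e) m
      ≡⟨ cong (_- Δ n (β e) m) (Δ-+ n (β e) later m) ⟩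
    Δ n (β e) m + Δ n later m - Δ n (β e) m
      ≡⟨ cancel (Δ n (β e) m) (Δ n later m) ⟩
    Δ n later m
      ≡⟨ Δ-∑ n e (λ t k → K (suc (toℕ t)) ℕ.* β (e ∸ suc (toℕ t)) k) m ⟩
    ℤΣ.sum {e} (λ t → Δ n (λ k → K (suc (toℕ t)) ℕ.* β (e ∸ suc (toℕ t)) k) m)
      ≡⟨ ℤΣ.sum-cong-≗ {e} (λ t → Δ-* n (K (suc (toℕ t))) (β (e ∸ suc (toℕ t))) m) ⟩
    ℤΣ.sum {e} (λ t → + K (suc (toℕ t)) * Δ n (β (e ∸ suc (toℕ t))) m)
      ∎
    where
    open ≡-Reasoning
    later : ℕ → ℕ
    later k = ℕΣ.sum {e} (λ t → K (suc (toℕ t)) ℕ.* β (e ∸ suc (toℕ t)) k)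
    cancel : ∀ a b → a + b - a ≡ b
    cancel = solve-∀

  ∸-suc< : ∀ {e} (t : Fin e) → e ∸ suc (toℕ t) < e
  ∸-suc< {e} t = ℕ.∸-monoʳ-< {e} (ℕ.s≤s ℕ.z≤n) (toℕ<n t)

  Δ-β-lower : ∀ n e m (c : ℕ → ℕ) → e ℕ.≤ n → (∀ e′ → e′ < n → Δ n (β e′) m ≡ + 0) →
              ℤΣ.sum {e} (λ t → + c (toℕ t) * Δ n (β (e ∸ suc (toℕ t))) m) ≡ + 0
  Δ-β-lower n e m c e≤n vanish = ∑-zero e _ λ t →
    trans (cong (+ c (toℕ t) *_) (vanish (e ∸ suc (toℕ t)) (ℕ.<-≤-trans (∸-suc< t) e≤n)))
          (*-zeroʳ (+ c (toℕ t)))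

  Δ-β-below : ∀ n e m → e < n → Δ n (β e) m ≡ + 0
  Δ-β-below (suc n) e m (ℕ.s≤s e≤n) =
    trans (Δ-β-suc n e m) (Δ-β-lower n e m (K ∘ suc) e≤n (λ e′ e′<n → Δ-β-below n e′ m e′<n))

  Δ-β-diagonal : ∀ n m → Δ n (β n) m ≡ + (5 ^ n)
  Δ-β-diagonal zero    m = cong (λ b → + 1 * + (1 ℕ.* b) + + 0) (β-zero (m ℕ.+ 0))
  Δ-β-diagonal (suc n) m = begin
    Δ (suc n) (β (suc n)) m              ≡⟨ Δ-β-suc n (suc n) m ⟩
    + K 1 * Δ n (β n) m + lower          ≡⟨ cong₂ _+_ (cong₂ (λ c x → + c * x) K₁≡5 (Δ-β-diagonal n m))
                                                      (Δ-β-lower n n m (K ∘ suc ∘ suc) ℕ.≤-refl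
                                                                 (λ e′ e′<n → Δ-β-below n e′ m e′<n)) ⟩
    + 5 * + (5 ^ n) + + 0                ≡⟨ +-identityʳ _ ⟩
    + 5 * + (5 ^ n)                      ≡⟨ pos-* 5 (5 ^ n) ⟨
    + (5 ^ suc n)                        ∎
    where
    open ≡-Reasoning
    lower = ℤΣ.sum {n} (λ t → + K (suc (suc (toℕ t))) * Δ n (β (n ∸ suc (toℕ t))) m)

open FiniteDifferences

theorem3p2 : (n m : ℕ) → lhs n m ≡ ℤ.+ (5 ^ n)
theorem3p2 n m = trans (lhs≡Δ n m) (Δ-β-diagonal n m)
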